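{- For every incidence graph $G$ and every integer $d\ge 0$, if $\mathrm{srbd}_{\mathscr{C}_0}(G)\le d$, then every clause of $G$ has width at most $d$, i.e.\ $G\in\mathscr{C}_d$.
   Context: CNF formulas are finite sets of clauses, each a finite set of literals $x_+$ or $x_-$ not containing both $x_+$ and $x_-$; formulas are identified with their incidence graphs (bipartite graphs on variables and clauses, with a positive edge $\{x,c\}$ if $x_+\in c$ and a negative edge if $x_-\in c$). The width of a clause $c$ is the number of variables in it; $\mathscr{C}_d$ is the class of formulas all of whose clauses have width at most $d$; in particular $\mathscr{C}_0$ consists of the formulas with no clauses or only empty clauses (edgeless incidence graphs). For a variable $x$ and polarity $\star\in\{+,-\}$, $G[x_\star]$ is the incidence graph of the formula obtained by setting $x$ to $\star$: delete all clauses containing $x_\star$ and delete the opposite literal of $x$ from the remaining clauses. For a class $\mathscr{C}$, $\mathrm{srbd}_{\mathscr{C}}(G)=0$ if $G\in\mathscr{C}$; $\mathrm{srbd}_{\mathscr{C}}(G)=1+\min_{x\in\mathrm{var}(G)}\max_{\star\in\{+,-\}}\mathrm{srbd}_{\mathscr{C}}(G[x_\star])$ if $G\notin\mathscr{C}$ and $G$ is connected; and otherwise $\mathrm{srbd}_{\mathscr{C}}(G)$ is the maximum of $\mathrm{srbd}_{\mathscr{C}}(H)$ over the connected components $H$ of $G$. -}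

module Defs where

open import Data.Nat using (ℕ; zero; suc; _≤_; _⊓_; _⊔_; _≡ᵇ_; _≤ᵇ_)
import Data.Nat as ℕ
open import Data.Bool using (Bool; true; false; _∧_; not; if_then_else_)
import Data.Bool as 𝔹
open import Data.List using (List; []; _∷_; map; filterᵇ; foldr; length; concatMap; partitionᵇ; deduplicate)
open import Data.Bool.ListAction using (any; all)
open import Data.List.Relation.Unary.All using (All)
open import Data.List.Relation.Unary.Unique.Propositional using (Unique)
open import Data.List.Membership.Propositional using (_∈_)
open import Data.Product using (_×_; _,_; proj₁; proj₂)
open import Relation.Nullary.Decidable using (⌊_⌋)
open import Relation.Binary.PropositionalEquality using (_≡_)

-- A literal is a pair (x , s) with
-- s = true for x₊ and s = false for x₋.  A clause is a list of literals
-- (read as a finite set), and an incidence graph is given by its list of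
-- variable vertices and its list of clause vertices; variable x is joined
-- to clause c (positively / negatively) iff (x , true) / (x , false) ∈ c.

Lit : Set
Lit = ℕ × Bool

Clause : Set
Clause = List Lit

record Graph : Set where
  constructor mkGraph
  field
    vars    : List ℕ
    clauses : List Clause
open Graph public

varsOf : Clause → List ℕ
varsOf c = map proj₁ c

-- Well-formedness (this is what it means to be an incidence graph of a
-- CNF formula): the variable vertices form a set, each clause contains
-- each variable at most once (so no duplicate literal and never both
-- x₊ and x₋), and every variable occurring in a clause is a vertex.
WellFormed : Graph → Set
WellFormed G =
  Unique (vars G) ×
  All (λ c → Unique (varsOf c) × All (λ x → x ∈ vars G) (varsOf c)) (clauses G)

width : Clause → ℕ
width c = length (deduplicate ℕ._≟_ (varsOf c))

InC : ℕ → Graph → Set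
InC d G = All (λ c → width c ≤ d) (clauses G)

inCᵇ : ℕ → Graph → Bool
inCᵇ d G = all (λ c → width c ≤ᵇ d) (clauses G)

_∈ᵇ_ : ℕ → List ℕ → Bool
x ∈ᵇ xs = any (λ y → x ≡ᵇ y) xs

hasLit : Lit → Clause → Bool
hasLit (x , s) c = any (λ l → (x ≡ᵇ proj₁ l) ∧ ⌊ s 𝔹.≟ proj₂ l ⌋) c

assign : Graph → ℕ → Bool → Graph
assign G x s = mkGraph
  (filterᵇ (λ y → not (x ≡ᵇ y)) (vars G))
  (map (filterᵇ (λ l → not (x ≡ᵇ proj₁ l)))
       (filterᵇ (λ c → not (hasLit (x , s) c)) (clauses G)))

-- a group of clauses connected through shared variables, with their variables
Group : Set
Group = List ℕ × List Clause

shares : List ℕ → Group → Bool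
shares vs g = any (λ y → y ∈ᵇ vs) (proj₁ g)

addClause : Clause → List Group → List Group
addClause c gs with partitionᵇ (λ g → shares (varsOf c) g) gs
... | touching , rest =
  (varsOf c Data.List.++ concatMap proj₁ touching , c ∷ concatMap proj₂ touching) ∷ rest

groups : List Clause → List Group
groups = foldr addClause []

-- components: the connected groups of clauses (with their variables), and
-- one single-vertex component for every variable occurring in no clause
components : Graph → List Graph
components G =
  map (λ g → mkGraph (deduplicate ℕ._≟_ (proj₁ g)) (proj₂ g)) (groups (clauses G))
  Data.List.++
  map (λ x → mkGraph (x ∷ []) [])
      (filterᵇ (λ x → not (x ∈ᵇ concatMap varsOf (clauses G))) (vars G))

isConnected : Graph → Bool
isConnected G = length (components G) ≡ᵇ 1

maxL : List ℕ → ℕ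
maxL = foldr _⊔_ 0

minL : List ℕ → ℕ
minL []       = 0
minL (x ∷ xs) = foldr _⊓_ x xs

module SRBD (inC : Graph → Bool) where
  mutual
    -- srbd with a fuel argument; fuel suc |var(G)| is always sufficient,
    -- since every recursive call through the connected case removes a variable
    srbdF : ℕ → Graph → ℕ
    srbdF zero    G = 0
    srbdF (suc n) G =
      if inC G then 0
      else if isConnected G then srbdConn n G
      else maxL (map (srbdConn n) (components G))

    srbdConn : ℕ → Graph → ℕ
    srbdConn n H =
      if inC H then 0
      else suc (minL (map (λ x → srbdF n (assign H x true) ⊔ srbdF n (assign H x false))
                          (vars H)))

  srbd : Graph → ℕ
  srbd G = srbdF (suc (length (vars G))) G

srbd : (Graph → Bool) → Graph → ℕ
srbd = SRBD.srbd

-- Splitting on a variable y never helps against a fixed clause c: setting y to the polarity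
-- opposite to its occurrence in c keeps c in the residual formula with at most one literal
-- fewer (and untouched if y ∉ c), and passing to connected components keeps c as well. So
-- along the branch that always picks this polarity, a clause of width w stays nonempty for
-- w − 1 splits and 𝒞₀ is reached only after w of them. The fuel of srbdF exceeds the number
-- of variables, hence every clause length, so the truncation of the recursion is harmless.
module Submission where

open import Defs
open import Data.Nat using (ℕ; zero; suc; _≤_; _⊓_; _⊔_; _≡ᵇ_; _≤ᵇ_; _≟_; z≤n; s≤s; s≤s⁻¹)
open import Data.Nat.Properties
open import Data.Bool using (Bool; true; false; not; T; T?; if_then_else_)
import Data.Bool as 𝔹
open import Data.Bool.Properties using (T-∧; not-¬)
open import Data.List using ([]; _∷_; map; filter; filterᵇ; foldr; length; partitionᵇ; deduplicate)
open import Data.List.Properties using (length-map; filter-all; filter-notAll; partition-defn)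
open import Data.List.Relation.Unary.All using (All; []; _∷_)
import Data.List.Relation.Unary.All as All
open import Data.List.Relation.Unary.All.Properties using (all⁺)
import Data.List.Relation.Unary.All.Properties as All
open import Data.List.Relation.Unary.Any using (here; there)
import Data.List.Relation.Unary.Any as Any
open import Data.List.Relation.Unary.Any.Properties using (any⁻)
open import Data.List.Relation.Unary.AllPairs using ([]; _∷_)
import Data.List.Relation.Unary.AllPairs.Properties as AllPairs
open import Data.List.Relation.Unary.Unique.Propositional using (Unique)
open import Data.List.Membership.Propositional using (_∈_; _∉_)
open import Data.List.Membership.Propositional.Properties
open import Data.List.Relation.Binary.Subset.Propositional using (_⊆_)
open import Data.Product using (∃; _×_; _,_; proj₁; proj₂)
open import Data.Sum using (_⊎_; inj₁; inj₂)
open import Function using (_∘_; id)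
open import Function.Bundles using (Equivalence)
open import Relation.Nullary using (¬_; ¬?; contradiction)
open import Relation.Nullary.Decidable using (toWitness; ⌊_⌋)
open import Relation.Binary.Definitions using (DecidableEquality)
open import Relation.Binary.PropositionalEquality using (_≡_; _≢_; refl; sym; cong; subst; module ≡-Reasoning)

open SRBD (inCᵇ 0) using (srbdF; srbdConn)

module _ {A : Set} (_≟_ : DecidableEquality A) where

  deduplicate-unique : ∀ {xs} → Unique xs → deduplicate _≟_ xs ≡ xs
  deduplicate-unique [] = refl
  deduplicate-unique {x ∷ xs} (x∉xs ∷ xs!) rewrite deduplicate-unique xs! =
    cong (x ∷_) (filter-all (¬? ∘ (x ≟_)) x∉xs)

  unique-⊆⇒length≤ : ∀ {xs ys} → Unique xs → xs ⊆ ys → length xs ≤ length ys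
  unique-⊆⇒length≤ {[]} _ _ = z≤n
  unique-⊆⇒length≤ {x ∷ xs} {ys} (x∉xs ∷ xs!) xs⊆ys =
    ≤-trans (s≤s (unique-⊆⇒length≤ xs! xs⊆ys-x))
            (filter-notAll (¬? ∘ (x ≟_)) ys (Any.map (λ eq ne → ne eq) (xs⊆ys (here refl))))
    where
    xs⊆ys-x : xs ⊆ filter (¬? ∘ (x ≟_)) ys
    xs⊆ys-x z∈xs = ∈-filter⁺ (¬? ∘ (x ≟_)) (xs⊆ys (there z∈xs)) (All.lookup x∉xs z∈xs)

width≡length : ∀ c → Unique (varsOf c) → width c ≡ length c
width≡length c c! rewrite deduplicate-unique _≟_ c! = length-map proj₁ c

≤-maxL : ∀ {x xs} → x ∈ xs → x ≤ maxL xs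
≤-maxL {xs = y ∷ ys} (here refl) = m≤m⊔n y (maxL ys)
≤-maxL {xs = y ∷ ys} (there x∈) = ≤-trans (≤-maxL x∈) (m≤n⊔m y (maxL ys))

minL-glb : ∀ {k x xs} → x ∈ xs → All (k ≤_) xs → k ≤ minL xs
minL-glb {xs = y ∷ ys} _ (k≤y ∷ k≤ys) = foldr-⊓-glb ys k≤y k≤ys
  where
  foldr-⊓-glb : ∀ {k y} ys → k ≤ y → All (k ≤_) ys → k ≤ foldr _⊓_ y ys
  foldr-⊓-glb [] k≤y [] = k≤y
  foldr-⊓-glb (z ∷ zs) k≤y (k≤z ∷ k≤zs) = ⊓-glb k≤z (foldr-⊓-glb zs k≤y k≤zs)

≤-⊔-Bool : (g : Bool → ℕ) (s : Bool) → g s ≤ g true ⊔ g false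
≤-⊔-Bool g true = m≤m⊔n (g true) (g false)
≤-⊔-Bool g false = m≤n⊔m (g true) (g false)

record IsClauseOf (G : Graph) (c : Clause) : Set where
  field
    member : c ∈ clauses G
    unique : Unique (varsOf c)
    scoped : varsOf c ⊆ vars G
open IsClauseOf

wellFormed⇒IsClauseOf : ∀ {G c} → WellFormed G → c ∈ clauses G → IsClauseOf G c
wellFormed⇒IsClauseOf (_ , clauses-wf) c∈G = record
  { member = c∈G
  ; unique = proj₁ (All.lookup clauses-wf c∈G)
  ; scoped = All.lookup (proj₂ (All.lookup clauses-wf c∈G))
  }

length≤#vars : ∀ {G c} → IsClauseOf G c → length c ≤ length (vars G)
length≤#vars {G} {c} c∈G = begin
  length c            ≡⟨ sym (length-map proj₁ c) ⟩
  length (varsOf c)   ≤⟨ unique-⊆⇒length≤ _≟_ (unique c∈G) (scoped c∈G) ⟩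
  length (vars G)     ∎
  where open ≤-Reasoning

¬T⇒T-not : ∀ {b} → ¬ T b → T (not b)
¬T⇒T-not {false} _ = _
¬T⇒T-not {true} ¬t = contradiction _ ¬t

≢⇒T-not-≡ᵇ : ∀ {y z} → y ≢ z → T (not (y ≡ᵇ z))
≢⇒T-not-≡ᵇ {y} {z} y≢z = ¬T⇒T-not (y≢z ∘ ≡ᵇ⇒≡ y z)

hasLit⇒∈ : ∀ l c → T (hasLit l c) → l ∈ c
hasLit⇒∈ (y , s) c t = Any.map same-literal (any⁻ _ c t)
  where
  same-literal : ∀ {l} → T ((y ≡ᵇ proj₁ l) 𝔹.∧ ⌊ s 𝔹.≟ proj₂ l ⌋) → (y , s) ≡ l
  same-literal {z , b} t with Equivalence.to T-∧ t
  ... | y≡ᵇz , s≟b with ≡ᵇ⇒≡ y z y≡ᵇz | toWitness s≟b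
  ...   | refl | refl = refl

polarity : ℕ → Clause → Bool
polarity y [] = true
polarity y ((z , b) ∷ c) = if y ≡ᵇ z then b else polarity y c

opposite-polarity-∉ : ∀ y c → Unique (varsOf c) → (y , not (polarity y c)) ∉ c
opposite-polarity-∉ y ((z , b) ∷ c) (z∉c ∷ c!) with y ≡ᵇ z in y≡ᵇz
... | true with refl ← ≡ᵇ⇒≡ y z (subst T (sym y≡ᵇz) _) =
  λ { (here eq) → not-¬ refl (sym (cong proj₂ eq))
    ; (there y∈c) → All.lookup z∉c (∈-map⁺ proj₁ y∈c) refl }
... | false =
  λ { (here refl) → subst T y≡ᵇz (≡⇒≡ᵇ y y refl)
    ; (there y∈c) → opposite-polarity-∉ y c c! y∈c }

dropVar : ℕ → Clause → Clause
dropVar y = filterᵇ (λ l → not (y ≡ᵇ proj₁ l))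

dropVar-fresh : ∀ {y} c → All (y ≢_) (varsOf c) → dropVar y c ≡ c
dropVar-fresh c y∉c = filter-all _ (All.map ≢⇒T-not-≡ᵇ (All.map⁻ y∉c))

length-dropVar : ∀ y c → Unique (varsOf c) → length c ≤ suc (length (dropVar y c))
length-dropVar y [] _ = z≤n
length-dropVar y ((z , b) ∷ c) (z∉c ∷ c!) with y ≡ᵇ z in y≡ᵇz
... | true rewrite ≡ᵇ⇒≡ y z (subst T (sym y≡ᵇz) _) | dropVar-fresh c z∉c = ≤-refl
... | false = s≤s (length-dropVar y c c!)

assign-dropVar : ∀ {H c} y s → (y , s) ∉ c → IsClauseOf H c →
                 IsClauseOf (assign H y s) (dropVar y c)
assign-dropVar {H} {c} y s ys∉c c∈H = record
  { member = ∈-map⁺ (dropVar y) (∈-filter⁺ (T? ∘ (not ∘ hasLit (y , s))) (member c∈H)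
                                           (¬T⇒T-not (ys∉c ∘ hasLit⇒∈ (y , s) c)))
  ; unique = AllPairs.map⁺ (AllPairs.filter⁺ _ (AllPairs.map⁻ (unique c∈H)))
  ; scoped = scoped′
  }
  where
  scoped′ : varsOf (dropVar y c) ⊆ vars (assign H y s)
  scoped′ x∈ with ∈-map⁻ proj₁ x∈
  ... | l , l∈ , refl with ∈-filter⁻ (T? ∘ (λ l → not (y ≡ᵇ proj₁ l))) {xs = c} l∈
  ...   | l∈c , y≢l = ∈-filter⁺ (T? ∘ (λ x → not (y ≡ᵇ x))) (scoped c∈H (∈-map⁺ proj₁ l∈c)) y≢l

∈-partitionᵇ : ∀ {A : Set} (p : A → Bool) {x} xs → x ∈ xs →
               x ∈ proj₁ (partitionᵇ p xs) ⊎ x ∈ proj₂ (partitionᵇ p xs)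
∈-partitionᵇ p {x} xs x∈ rewrite partition-defn (T? ∘ p) xs with p x in px
... | true  = inj₁ (∈-filter⁺ (T? ∘ p) x∈ (subst T (sym px) _))
... | false = inj₂ (∈-filter⁺ _ x∈ (subst T px))

Covers : Group → Clause → Set
Covers g c = c ∈ proj₂ g × varsOf c ⊆ proj₁ g

_⊑_ : Group → Group → Set
g ⊑ g′ = proj₁ g ⊆ proj₁ g′ × proj₂ g ⊆ proj₂ g′

addClause-covers : ∀ c gs → ∃ λ g → g ∈ addClause c gs × Covers g c
addClause-covers c gs with partitionᵇ (shares (varsOf c)) gs
... | _ = _ , here refl , here refl , ∈-++⁺ˡ

addClause-extends : ∀ c gs {g} → g ∈ gs → ∃ λ g′ → g′ ∈ addClause c gs × g ⊑ g′
addClause-extends c gs g∈ with ∈-partitionᵇ (shares (varsOf c)) gs g∈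
... | inj₁ g∈touching with partitionᵇ (shares (varsOf c)) gs
...   | touching , _ =
  _ , here refl ,
  (∈-++⁺ʳ (varsOf c) ∘ ∈-concatMap⁺ proj₁ ∘ λ x∈ → Any.map (λ { refl → x∈ }) g∈touching) ,
  (there ∘ ∈-concatMap⁺ proj₂ ∘ λ x∈ → Any.map (λ { refl → x∈ }) g∈touching)
addClause-extends c gs g∈ | inj₂ g∈rest with partitionᵇ (shares (varsOf c)) gs
...   | _ , _ = _ , there g∈rest , id , id

∈-groups : ∀ {c} cs → c ∈ cs → ∃ λ g → g ∈ groups cs × Covers g c
∈-groups (c ∷ cs) (here refl) = addClause-covers c (groups cs)
∈-groups (c′ ∷ cs) (there c∈) with ∈-groups cs c∈
... | g , g∈ , c∈g , c⊆g with addClause-extends c′ (groups cs) g∈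
...   | g′ , g′∈ , vars⊑ , clauses⊑ = g′ , g′∈ , clauses⊑ c∈g , vars⊑ ∘ c⊆g

∈-components : ∀ {G c} → IsClauseOf G c → ∃ λ H → H ∈ components G × IsClauseOf H c
∈-components {G} c∈G with ∈-groups (clauses G) (member c∈G)
... | g , g∈ , c∈g , c⊆g =
  _ , ∈-++⁺ˡ (∈-map⁺ (λ g → mkGraph (deduplicate _≟_ (proj₁ g)) (proj₂ g)) g∈) ,
  record { member = c∈g ; unique = unique c∈G ; scoped = ∈-deduplicate⁺ _≟_ ∘ c⊆g }

inC₀⇒length≡0 : ∀ {G c} → inCᵇ 0 G ≡ true → IsClauseOf G c → length c ≡ 0
inC₀⇒length≡0 {G} {c} G∈𝒞₀ c∈G = begin
  length c          ≡⟨ sym (width≡length c (unique c∈G)) ⟩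
  width c           ≡⟨ n≤0⇒n≡0 (≤ᵇ⇒≤ (width c) 0 width≤ᵇ0) ⟩
  0                 ∎
  where
  open ≡-Reasoning
  width≤ᵇ0 : T (width c ≤ᵇ 0)
  width≤ᵇ0 = All.lookup (all⁺ _ (clauses G) (subst T (sym G∈𝒞₀) _)) (member c∈G)

splitCost : ℕ → Graph → ℕ → ℕ
splitCost n H y = srbdF n (assign H y true) ⊔ srbdF n (assign H y false)

mutual
  length⊓fuel≤srbdF : ∀ n G {c} → IsClauseOf G c → length c ⊓ n ≤ srbdF n G
  length⊓fuel≤srbdF zero G {c} _ = m⊓n≤n (length c) 0
  length⊓fuel≤srbdF (suc n) G {c} c∈G with inCᵇ 0 G in G∈𝒞₀
  ... | true = ≤-trans (m⊓n≤m _ _) (≤-reflexive (inC₀⇒length≡0 G∈𝒞₀ c∈G))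
  ... | false with isConnected G
  ...   | true = length⊓fuel≤split n G c∈G
  ...   | false with ∈-components c∈G
  ...     | H , H∈ , c∈H =
    ≤-trans (length⊓fuel≤srbdConn n H c∈H) (≤-maxL (∈-map⁺ (srbdConn n) H∈))

  length⊓fuel≤srbdConn : ∀ n H {c} → IsClauseOf H c → length c ⊓ suc n ≤ srbdConn n H
  length⊓fuel≤srbdConn n H c∈H with inCᵇ 0 H in H∈𝒞₀
  ... | true  = ≤-trans (m⊓n≤m _ _) (≤-reflexive (inC₀⇒length≡0 H∈𝒞₀ c∈H))
  ... | false = length⊓fuel≤split n H c∈H

  length⊓fuel≤split : ∀ n H {c} → IsClauseOf H c →
                      length c ⊓ suc n ≤ suc (minL (map (splitCost n H) (vars H)))
  length⊓fuel≤split n H {[]} _ = z≤n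
  length⊓fuel≤split n H {l ∷ c} c∈H =
    s≤s (minL-glb (∈-map⁺ (splitCost n H) (scoped c∈H (here refl)))
                  (All.map⁺ (All.tabulate (λ {y} _ → bound y))))
    where
    bound : ∀ y → length c ⊓ n ≤ splitCost n H y
    bound y = begin
      length c ⊓ n                    ≤⟨ ⊓-monoˡ-≤ n (s≤s⁻¹ (length-dropVar y (l ∷ c) (unique c∈H))) ⟩
      length (dropVar y (l ∷ c)) ⊓ n  ≤⟨ length⊓fuel≤srbdF n _ (assign-dropVar y s y,s∉c c∈H) ⟩
      srbdF n (assign H y s)          ≤⟨ ≤-⊔-Bool (srbdF n ∘ assign H y) s ⟩
      splitCost n H y                 ∎
      where
      open ≤-Reasoning
      s : Bool
      s = not (polarity y (l ∷ c))
      y,s∉c : (y , s) ∉ l ∷ c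
      y,s∉c = opposite-polarity-∉ y (l ∷ c) (unique c∈H)

lemma5p1 : (G : Graph) → WellFormed G → (d : ℕ) → srbd (inCᵇ 0) G ≤ d → InC d G
lemma5p1 G wf d srbd≤d = All.tabulate width≤d
  where
  width≤d : ∀ {c} → c ∈ clauses G → width c ≤ d
  width≤d {c} c∈G = begin
    width c                           ≡⟨ width≡length c (unique c∈G′) ⟩
    length c                          ≡⟨ sym (m≤n⇒m⊓n≡m (m≤n⇒m≤1+n (length≤#vars c∈G′))) ⟩
    length c ⊓ suc (length (vars G))  ≤⟨ length⊓fuel≤srbdF _ G c∈G′ ⟩
    srbd (inCᵇ 0) G                   ≤⟨ srbd≤d ⟩
    d                                 ∎
    where
    open ≤-Reasoning
    c∈G′ : IsClauseOf G c
    c∈G′ = wellFormed⇒IsClauseOf wf c∈G
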